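{- In the probabilistic weak call-by-value $\lambda$-calculus $\Lambda_\oplus^{\mathrm{weak}}$, every multidistribution $\mathrm{m}$ satisfies: (i) all $\Rightarrow$-sequences from $\mathrm{m}$ converge to the same limit distribution; (ii) all $\Rightarrow$-sequences from $\mathrm{m}$ have the same expected termination time $\mathrm{MeanTime}$; (iii) for all $k$ and all $\mathrm{s},\mathrm{t}$, if $\mathrm{m}\Rightarrow^k\mathrm{s}$ and $\mathrm{m}\Rightarrow^k\mathrm{t}$ then $\mathrm{nf}(\mathrm{s})=\mathrm{nf}(\mathrm{t})$.
   Context: Terms $M::=x\mid\lambda x.M\mid MM\mid M\oplus M$ (up to $\alpha$-equivalence); values $V::=x\mid\lambda x.M$; $M[x:=V]$ is capture-avoiding substitution. The relation $\to$ from terms to finitely supported probability distributions on terms is inductively defined by: $(\lambda x.M)V\to\{M[x:=V]^1\}$; $P\oplus Q\to\{P^{1/2}\}+\{Q^{1/2}\}$; if $N\to\{N_i^{p_i}\mid i\in I\}$ then $MN\to\{(MN_i)^{p_i}\mid i\in I\}$; if $M\to\{M_i^{p_i}\mid i\in I\}$ then $MN\to\{(M_iN)^{p_i}\mid i\in I\}$. A term is a normal form if it has no $\to$-reduction; $\mathrm{NF}$ is the set of normal forms. A multidistribution is a finite multiset $[p_iM_i\mid i\in I]$ with $p_i\in(0,1]$, $\sum p_i\le1$; $[M]=[1M]$, $+$ is multiset union, $q\cdot[p_iM_i]=[(qp_i)M_i]$. $\Rightarrow$ is the least relation on multidistributions with: (L1) $[M]\Rightarrow[M]$ for $M$ normal;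 (L2) $[M]\Rightarrow[p_kM_k\mid k\in K]$ if $M\to\{M_k^{p_k}\mid k\in K\}$; (L3) if $[M_i]\Rightarrow\mathrm{m}_i$ for all $i$ then $[p_iM_i\mid i\in I]\Rightarrow\sum_ip_i\cdot\mathrm{m}_i$. $\Rightarrow^k$ denotes exactly $k$ steps. $\mathrm{nf}(\mathrm{m})(U)=\sum_{i:M_i=U}p_i$ for $U\in\mathrm{NF}$, and $\|\mathrm{nf}(\mathrm{m})\|$ its total mass. A $\Rightarrow$-sequence from $\mathrm{m}$ is an infinite sequence $\mathrm{m}=\mathrm{m}_0\Rightarrow\mathrm{m}_1\Rightarrow\cdots$; it converges to the subdistribution $\beta$ on $\mathrm{NF}$ with $\beta(U)=\sup_n\mathrm{nf}(\mathrm{m}_n)(U)$ (its limit distribution), and its expected termination time is $\mathrm{MeanTime}=\sum_n(1-\|\mathrm{nf}(\mathrm{m}_n)\|)\in[0,\infty]$.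
   Formalization: The weights $p_i$ of every multidistribution $\mathrm{m}$ are rational. -}

module Defs where

open import Data.Nat as ℕ using (ℕ; zero; suc; compare; less; equal; greater)
open import Data.Rational as ℚ using (ℚ; 0ℚ; 1ℚ; ½; _+_; _*_; _-_; _≤_; _<_)
open import Data.List using (List; []; _∷_; _++_; map)
open import Data.List.Relation.Unary.All using (All)
open import Data.Product using (Σ; ∃; ∃-syntax; _×_; _,_; proj₁; proj₂)
open import Data.Sum using (_⊎_; inj₁; inj₂)
open import Data.Empty using (⊥; ⊥-elim)
open import Relation.Nullary using (¬_; Dec; yes; no)
open import Relation.Binary.PropositionalEquality using (_≡_; refl; cong; cong₂)

-- Terms of Λ⊕ (de Bruijn indices, so terms are up to α-equivalence)

infixl 7 _·_
infixl 6 _⊕_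

data Term : Set where
  var : ℕ → Term
  lam : Term → Term
  _·_ : Term → Term → Term
  _⊕_ : Term → Term → Term

data Value : Term → Set where
  var-val : ∀ i → Value (var i)
  lam-val : ∀ M → Value (lam M)

shift : ℕ → Term → Term
shift c (var i) with compare i c
... | less _ _      = var i
... | equal _      = var (suc i)
... | greater _ _  = var (suc i)
shift c (lam M) = lam (shift (suc c) M)
shift c (M · N) = shift c M · shift c N
shift c (M ⊕ N) = shift c M ⊕ shift c N

-- subst j N M : replace variable j by N in M, decrementing variables > j
subst : ℕ → Term → Term → Term
subst j N (var i) with compare i j
... | less _ _      = var i
... | equal _      = N
... | greater _ k  = var (j ℕ.+ k)
subst j N (lam M) = lam (subst (suc j) (shift 0 N) M)
subst j N (M · M') = subst j N M · subst j N M'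
subst j N (M ⊕ M') = subst j N M ⊕ subst j N M'

-- M [x := V] where x is the bound variable of λx.M
_[0:=_] : Term → Term → Term
M [0:= V ] = subst 0 V M

private
  lam-inj : ∀ {M N} → lam M ≡ lam N → M ≡ N
  lam-inj refl = refl
  var-inj : ∀ {i j} → var i ≡ var j → i ≡ j
  var-inj refl = refl
  app-inj₁ : ∀ {M N M' N'} → M · N ≡ M' · N' → M ≡ M'
  app-inj₁ refl = refl
  app-inj₂ : ∀ {M N M' N'} → M · N ≡ M' · N' → N ≡ N'
  app-inj₂ refl = refl
  sum-inj₁ : ∀ {M N M' N'} → M ⊕ N ≡ M' ⊕ N' → M ≡ M'
  sum-inj₁ refl = refl
  sum-inj₂ : ∀ {M N M' N'} → M ⊕ N ≡ M' ⊕ N' → N ≡ N'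
  sum-inj₂ refl = refl

_≟T_ : (M N : Term) → Dec (M ≡ N)
var i ≟T var j with i ℕ.≟ j
... | yes refl = yes refl
... | no ne = no (λ e → ne (var-inj e))
var _ ≟T lam _ = no λ ()
var _ ≟T (_ · _) = no λ ()
var _ ≟T (_ ⊕ _) = no λ ()
lam _ ≟T var _ = no λ ()
lam M ≟T lam N with M ≟T N
... | yes refl = yes refl
... | no ne = no (λ e → ne (lam-inj e))
lam _ ≟T (_ · _) = no λ ()
lam _ ≟T (_ ⊕ _) = no λ ()
(_ · _) ≟T var _ = no λ ()
(_ · _) ≟T lam _ = no λ ()
(M · N) ≟T (M' · N') with M ≟T M' | N ≟T N'
... | yes refl | yes refl = yes refl
... | no ne | _ = no (λ e → ne (app-inj₁ e))
... | yes _ | no ne = no (λ e → ne (app-inj₂ e))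
(_ · _) ≟T (_ ⊕ _) = no λ ()
(_ ⊕ _) ≟T var _ = no λ ()
(_ ⊕ _) ≟T lam _ = no λ ()
(_ ⊕ _) ≟T (_ · _) = no λ ()
(M ⊕ N) ≟T (M' ⊕ N') with M ≟T M' | N ≟T N'
... | yes refl | yes refl = yes refl
... | no ne | _ = no (λ e → ne (sum-inj₁ e))
... | yes _ | no ne = no (λ e → ne (sum-inj₂ e))

-- Finitely supported distributions, represented as lists of
-- (probability, term) pairs with pairwise distinct terms.

Dist : Set
Dist = List (ℚ × Term)

half : Term → Term → Dist
half P Q with P ≟T Q
... | yes _ = (1ℚ , P) ∷ []
... | no _  = (½ , P) ∷ (½ , Q) ∷ []

mapD : (Term → Term) → Dist → Dist
mapD f = map (λ pM → proj₁ pM , f (proj₂ pM))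

infix 4 _↦_
data _↦_ : Term → Dist → Set where
  β    : ∀ {M V} → Value V → lam M · V ↦ (1ℚ , M [0:= V ]) ∷ []
  ⊕-r  : ∀ {P Q} → P ⊕ Q ↦ half P Q
  appR : ∀ {M N d} → N ↦ d → M · N ↦ mapD (λ N' → M · N') d
  appL : ∀ {M N d} → M ↦ d → M · N ↦ mapD (λ M' → M' · N) d

Normal : Term → Set
Normal M = ∀ d → ¬ (M ↦ d)

private
  Red : Term → Set
  Red M = ∃[ d ] (M ↦ d)

  red? : (M : Term) → Dec (Red M)
  red? (var i) = no λ { (_ , ()) }
  red? (lam M) = no λ { (_ , ()) }
  red? (P ⊕ Q) = yes (_ , ⊕-r)
  red? (M · N) with red? M | red? N
  ... | yes (d , r) | _ = yes (_ , appL r)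
  ... | no _ | yes (d , r) = yes (_ , appR r)
  ... | no nM | no nN = helper M N nM nN
    where
    inv : ∀ {M N d} → ¬ Red M → ¬ Red N → M · N ↦ d → ∃[ B ] (M ≡ lam B × Value N)
    inv nM nN (β v) = _ , refl , v
    inv nM nN (appR r) = ⊥-elim (nN (_ , r))
    inv nM nN (appL r) = ⊥-elim (nM (_ , r))
    helper : (M N : Term) → ¬ Red M → ¬ Red N → Dec (Red (M · N))
    helper (lam B) (var i) _ _ = yes (_ , β (var-val i))
    helper (lam B) (lam C) _ _ = yes (_ , β (lam-val C))
    helper (lam B) (N · N') nM nN = no λ { (_ , r) → bad (inv nM nN r) }
      where bad : ∃[ B' ] (lam B ≡ lam B' × Value (N · N')) → ⊥
            bad (_ , _ , ())
    helper (lam B) (N ⊕ N') nM nN = no λ { (_ , r) → bad (inv nM nN r) }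
      where bad : ∃[ B' ] (lam B ≡ lam B' × Value (N ⊕ N')) → ⊥
            bad (_ , _ , ())
    helper (var i) N nM nN = no λ { (_ , r) → bad (inv nM nN r) }
      where bad : ∃[ B' ] (var i ≡ lam B' × Value N) → ⊥
            bad (_ , () , _)
    helper (M · M') N nM nN = no λ { (_ , r) → bad (inv nM nN r) }
      where bad : ∃[ B' ] (M · M' ≡ lam B' × Value N) → ⊥
            bad (_ , () , _)
    helper (M ⊕ M') N nM nN = no λ { (_ , r) → bad (inv nM nN r) }
      where bad : ∃[ B' ] (M ⊕ M' ≡ lam B' × Value N) → ⊥
            bad (_ , () , _)

normal? : (M : Term) → Dec (Normal M)
normal? M with red? M
... | yes (d , r) = no λ n → n d r
... | no nr = yes λ d r → nr (d , r)

-- Multidistributions: finite multisets [p_i M_i], represented as lists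

MDist : Set
MDist = List (ℚ × Term)

[_] : Term → MDist
[ M ] = (1ℚ , M) ∷ []

_·m_ : ℚ → MDist → MDist
q ·m m = map (λ pM → q * proj₁ pM , proj₂ pM) m

sumQ : List ℚ → ℚ
sumQ [] = 0ℚ
sumQ (x ∷ xs) = x + sumQ xs

IsMultidist : MDist → Set
IsMultidist m = All (λ pM → (0ℚ < proj₁ pM) × (proj₁ pM ≤ 1ℚ)) m
              × (sumQ (map proj₁ m) ≤ 1ℚ)

infix 4 _⇒_
mutual
  data _⇒_ : MDist → MDist → Set where
    L1 : ∀ {M} → Normal M → [ M ] ⇒ [ M ]
    L2 : ∀ {M d} → M ↦ d → [ M ] ⇒ d
    L3 : ∀ {m n} → Lift m n → m ⇒ n

  data Lift : MDist → MDist → Set where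
    []  : Lift [] []
    _∷_ : ∀ {p M mᵢ ms ns} → [ M ] ⇒ mᵢ → Lift ms ns → Lift ((p , M) ∷ ms) ((p ·m mᵢ) ++ ns)

data _⇒^_∙_ : MDist → ℕ → MDist → Set where
  done : ∀ {m} → m ⇒^ zero ∙ m
  more : ∀ {m n o k} → m ⇒ n → n ⇒^ k ∙ o → m ⇒^ suc k ∙ o

nf : MDist → Term → ℚ
nf [] U = 0ℚ
nf ((p , M) ∷ m) U with M ≟T U
... | yes _ = p + nf m U
... | no _  = nf m U

mass : MDist → ℚ
mass [] = 0ℚ
mass ((p , M) ∷ m) with normal? M
... | yes _ = p + mass m
... | no _  = mass m

IsSeq : MDist → (ℕ → MDist) → Set
IsSeq m f = (f zero ≡ m) × (∀ n → f n ⇒ f (suc n))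

-- Equality of the suprema (in [0,∞]) of two ℚ-valued sequences,
-- stated without real numbers:  sup a ≤ sup b  iff
-- ∀ n, ∀ ε > 0, ∃ n', a n ≤ b n' + ε.
SupLe : (ℕ → ℚ) → (ℕ → ℚ) → Set
SupLe a b = ∀ n (ε : ℚ) → 0ℚ < ε → ∃[ n' ] (a n ≤ b n' + ε)

SupEq : (ℕ → ℚ) → (ℕ → ℚ) → Set
SupEq a b = SupLe a b × SupLe b a

-- the two sequences have the same limit distribution:
-- for every normal form U, sup_n nf(f n)(U) = sup_n nf(g n)(U)
SameLimit : (ℕ → MDist) → (ℕ → MDist) → Set
SameLimit f g = ∀ U → Normal U → SupEq (λ n → nf (f n) U) (λ n → nf (g n) U)

partialTime : (ℕ → MDist) → ℕ → ℚ
partialTime f zero = 0ℚ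
partialTime f (suc N) = partialTime f N + (1ℚ - mass (f N))

-- MeanTime(f) = MeanTime(g) in [0,∞] (sup of partial sums of a
-- nonnegative series)
SameMeanTime : (ℕ → MDist) → (ℕ → MDist) → Set
SameMeanTime f g = SupEq (partialTime f) (partialTime g)

-- Fix an observable g : Term → ℚ, read only on normal forms, and let expect k M be
-- the expected observation after k steps of one fixed reduction strategy from M.
-- The strategy does not matter: if M ↦ d by any rule, then expect (k+1) M is the
-- d-average of expect k.  Two different redexes of M lie in disjoint subterms
-- M₁ and M₂ of an application, and contracting both in either order gives the same
-- product distribution, so in expectation the claim is Fubini's theorem.  Hence
-- every ⇒-step from m to n turns the average of expect (k+1) over m into the average
-- of expect k over n, and after k steps the average of g over the normal forms
-- reached depends on m and k alone.  Taking for g the indicator of a normal form U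
-- gives nf(s)(U), taking g = 1 gives ‖nf(s)‖; so any two ⇒-sequences from m agree
-- termwise on nf and on the termination mass, which yields (i)–(iii).
module Submission where

open import Defs
open import Algebra.Bundles using (CommutativeMonoid)
import Algebra.Properties.CommutativeSemigroup as CommSemigroupProperties
open import Data.Empty using (⊥-elim)
open import Data.List using (List; []; _∷_; _++_)
open import Data.List.Properties using (map-id; map-∘)
open import Data.Nat using (ℕ; zero; suc)
open import Data.Product using (Σ; _×_; _,_)
open import Data.Rational using (ℚ; 0ℚ; 1ℚ; _+_; _*_; _-_; _≤_)
open import Data.Rational.Properties
  using ( +-identityˡ; +-identityʳ; +-assoc; *-identityˡ; *-identityʳ; *-zeroʳ; *-assoc
        ; *-distribˡ-+; +-0-commutativeMonoid; *-1-commutativeMonoid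
        ; +-monoʳ-≤; <⇒≤ )
open import Data.Sum using (_⊎_; inj₁; inj₂)
open import Function using (_∘_; id)
open import Relation.Nullary using (¬_; Dec; yes; no)
import Relation.Binary.PropositionalEquality as ≡
open ≡ using (_≡_; refl; sym; trans; cong; cong₂; _≗_; module ≡-Reasoning)

open CommSemigroupProperties (CommutativeMonoid.commutativeSemigroup +-0-commutativeMonoid)
  using () renaming (interchange to +-interchange)
open CommSemigroupProperties (CommutativeMonoid.commutativeSemigroup *-1-commutativeMonoid)
  using () renaming (x∙yz≈y∙xz to *-leftSwap)

private variable A B : Set

𝔼 : List (ℚ × A) → (A → ℚ) → ℚ
𝔼 []            h = 0ℚ
𝔼 ((p , M) ∷ d) h = p * h M + 𝔼 d h

𝔼-cong : ∀ (d : List (ℚ × A)) {h h′} → h ≗ h′ → 𝔼 d h ≡ 𝔼 d h′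
𝔼-cong []            e = refl
𝔼-cong ((p , M) ∷ d) e = cong₂ _+_ (cong (p *_) (e M)) (𝔼-cong d e)

𝔼-zero : ∀ (d : List (ℚ × A)) {h} → (∀ M → h M ≡ 0ℚ) → 𝔼 d h ≡ 0ℚ
𝔼-zero []            e = refl
𝔼-zero ((p , M) ∷ d) e =
  cong₂ _+_ (trans (cong (p *_) (e M)) (*-zeroʳ p)) (𝔼-zero d e)

𝔼-++ : ∀ (d e : List (ℚ × A)) h → 𝔼 (d ++ e) h ≡ 𝔼 d h + 𝔼 e h
𝔼-++ []            e h = sym (+-identityˡ _)
𝔼-++ ((p , M) ∷ d) e h =
  trans (cong (p * h M +_) (𝔼-++ d e h)) (sym (+-assoc (p * h M) (𝔼 d h) (𝔼 e h)))

𝔼-*ˡ : ∀ q (d : List (ℚ × A)) h → 𝔼 d (λ M → q * h M) ≡ q * 𝔼 d h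
𝔼-*ˡ q []            h = sym (*-zeroʳ q)
𝔼-*ˡ q ((p , M) ∷ d) h = begin
  p * (q * h M) + 𝔼 d (λ M′ → q * h M′) ≡⟨ cong₂ _+_ (*-leftSwap p q (h M)) (𝔼-*ˡ q d h) ⟩
  q * (p * h M) + q * 𝔼 d h             ≡⟨ sym (*-distribˡ-+ q _ _) ⟩
  q * (p * h M + 𝔼 d h)                 ∎
  where open ≡-Reasoning

𝔼-+ : ∀ (d : List (ℚ × A)) h h′ → 𝔼 d (λ M → h M + h′ M) ≡ 𝔼 d h + 𝔼 d h′
𝔼-+ []            h h′ = refl
𝔼-+ ((p , M) ∷ d) h h′ = begin
  p * (h M + h′ M) + 𝔼 d (λ M′ → h M′ + h′ M′) ≡⟨ cong₂ _+_ (*-distribˡ-+ p _ _) (𝔼-+ d h h′) ⟩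
  (p * h M + p * h′ M) + (𝔼 d h + 𝔼 d h′)      ≡⟨ +-interchange (p * h M) (p * h′ M) (𝔼 d h) (𝔼 d h′) ⟩
  (p * h M + 𝔼 d h) + (p * h′ M + 𝔼 d h′)      ∎
  where open ≡-Reasoning

𝔼-swap : ∀ (d : List (ℚ × A)) (e : List (ℚ × B)) (F : A → B → ℚ) →
         𝔼 d (λ a → 𝔼 e (F a)) ≡ 𝔼 e (λ b → 𝔼 d (λ a → F a b))
𝔼-swap []            e F = sym (𝔼-zero e (λ _ → refl))
𝔼-swap ((p , a) ∷ d) e F = begin
  p * 𝔼 e (F a) + 𝔼 d (λ a′ → 𝔼 e (F a′))
    ≡⟨ cong₂ _+_ (sym (𝔼-*ˡ p e (F a))) (𝔼-swap d e F) ⟩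
  𝔼 e (λ b → p * F a b) + 𝔼 e (λ b → 𝔼 d (λ a′ → F a′ b))
    ≡⟨ sym (𝔼-+ e _ _) ⟩
  𝔼 e (λ b → p * F a b + 𝔼 d (λ a′ → F a′ b))
    ∎
  where open ≡-Reasoning

𝔼-·m : ∀ q m h → 𝔼 (q ·m m) h ≡ q * 𝔼 m h
𝔼-·m q []            h = sym (*-zeroʳ q)
𝔼-·m q ((p , M) ∷ m) h = begin
  q * p * h M + 𝔼 (q ·m m) h ≡⟨ cong₂ _+_ (*-assoc q p (h M)) (𝔼-·m q m h) ⟩
  q * (p * h M) + q * 𝔼 m h  ≡⟨ sym (*-distribˡ-+ q _ _) ⟩
  q * (p * h M + 𝔼 m h)      ∎
  where open ≡-Reasoning

𝔼-mapD : ∀ d F h → 𝔼 (mapD F d) h ≡ 𝔼 d (h ∘ F)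
𝔼-mapD []            F h = refl
𝔼-mapD ((p , M) ∷ d) F h = cong (p * h (F M) +_) (𝔼-mapD d F h)

𝔼-[] : ∀ M h → 𝔼 [ M ] h ≡ h M
𝔼-[] M h = trans (+-identityʳ _) (*-identityˡ (h M))

value? : ∀ N → Dec (Value N)
value? (var i) = yes (var-val i)
value? (lam M) = yes (lam-val M)
value? (_ · _) = no λ ()
value? (_ ⊕ _) = no λ ()

app-normal : ∀ {M N} → Normal M → Normal N → (∀ {B} → M ≡ lam B → ¬ Value N) →
             Normal (M · N)
app-normal nM nN noβ _ (β v)    = noβ refl v
app-normal nM nN noβ _ (appR r) = nN _ r
app-normal nM nN noβ _ (appL r) = nM _ r

progress : ∀ M → Normal M ⊎ Σ Dist (M ↦_)
progress (var i) = inj₁ λ _ ()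
progress (lam M) = inj₁ λ _ ()
progress (P ⊕ Q) = inj₂ (_ , ⊕-r)
progress (M · N) with progress M | progress N
... | inj₂ (_ , r) | _            = inj₂ (_ , appL r)
... | inj₁ _       | inj₂ (_ , r) = inj₂ (_ , appR r)
... | inj₁ nM      | inj₁ nN      = progress-app M N nM nN
  where
  progress-app : ∀ M N → Normal M → Normal N → Normal (M · N) ⊎ Σ Dist (M · N ↦_)
  progress-app (lam B) N nM nN with value? N
  ... | yes v  = inj₂ (_ , β v)
  ... | no ¬v  = inj₁ (app-normal nM nN λ { refl → ¬v })
  progress-app (var _) N nM nN = inj₁ (app-normal nM nN λ ())
  progress-app (_ · _) N nM nN = inj₁ (app-normal nM nN λ ())
  progress-app (_ ⊕ _) N nM nN = inj₁ (app-normal nM nN λ ())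

Compatible : (Term → Term) → Set
Compatible F = ∀ {X d} → X ↦ d → F X ↦ mapD F d

id-compatible : Compatible id
id-compatible {X} {d} r = ≡.subst (X ↦_) (sym (map-id d)) r

∘-compatible : ∀ {F G} → Compatible F → Compatible G → Compatible (F ∘ G)
∘-compatible {F} {G} Fc Gc {X} {d} r = ≡.subst (F (G X) ↦_) (sym (map-∘ d)) (Fc (Gc r))

module Observation (g : Term → ℚ) where

  observe : Term → ℚ
  observe M with normal? M
  ... | yes _ = g M
  ... | no _  = 0ℚ

  observe-reducible : ∀ {M d} → M ↦ d → observe M ≡ 0ℚ
  observe-reducible {M} r with normal? M
  ... | yes nM = ⊥-elim (nM _ r)
  ... | no _   = refl

  expect : ℕ → Term → ℚ
  expect zero    M = observe M
  expect (suc k) M with progress M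
  ... | inj₁ _       = observe M
  ... | inj₂ (d , _) = 𝔼 d (expect k)

  expect-normal : ∀ k {M} → Normal M → expect k M ≡ observe M
  expect-normal zero    nM = refl
  expect-normal (suc k) {M} nM with progress M
  ... | inj₁ _       = refl
  ... | inj₂ (_ , r) = ⊥-elim (nM _ r)

  -- Terminates because every cycle of calls passes through expect-step, lowering k.
  mutual
    reducts-agree : ∀ k {F} → Compatible F → ∀ {X d₁ d₂} → X ↦ d₁ → X ↦ d₂ →
                    𝔼 d₁ (expect k ∘ F) ≡ 𝔼 d₂ (expect k ∘ F)
    reducts-agree k Fc (β _)    (β _)    = refl
    reducts-agree k Fc ⊕-r      ⊕-r      = refl
    reducts-agree k Fc (β (var-val _)) (appR ())
    reducts-agree k Fc (β (lam-val _)) (appR ())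
    reducts-agree k Fc (β _)    (appL ())
    reducts-agree k Fc (appR ()) (β (var-val _))
    reducts-agree k Fc (appR ()) (β (lam-val _))
    reducts-agree k Fc (appL ()) (β _)
    reducts-agree k {F} Fc (appL {N = N} {d₁} r₁) (appL {d = d₂} r₂) = begin
      𝔼 (mapD (_· N) d₁) (expect k ∘ F) ≡⟨ 𝔼-mapD d₁ (_· N) _ ⟩
      𝔼 d₁ (expect k ∘ F ∘ (_· N))      ≡⟨ reducts-agree k (∘-compatible Fc appL) r₁ r₂ ⟩
      𝔼 d₂ (expect k ∘ F ∘ (_· N))      ≡⟨ sym (𝔼-mapD d₂ (_· N) _) ⟩
      𝔼 (mapD (_· N) d₂) (expect k ∘ F) ∎
      where open ≡-Reasoning
    reducts-agree k {F} Fc (appR {M} {d = d₁} r₁) (appR {d = d₂} r₂) = begin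
      𝔼 (mapD (M ·_) d₁) (expect k ∘ F) ≡⟨ 𝔼-mapD d₁ (M ·_) _ ⟩
      𝔼 d₁ (expect k ∘ F ∘ (M ·_))      ≡⟨ reducts-agree k (∘-compatible Fc appR) r₁ r₂ ⟩
      𝔼 d₂ (expect k ∘ F ∘ (M ·_))      ≡⟨ sym (𝔼-mapD d₂ (M ·_) _) ⟩
      𝔼 (mapD (M ·_) d₂) (expect k ∘ F) ∎
      where open ≡-Reasoning
    reducts-agree k {F} Fc (appL {M} {N} {d₁} r₁) (appR {d = d₂} r₂) = begin
      𝔼 (mapD (_· N) d₁) (expect k ∘ F) ≡⟨ 𝔼-mapD d₁ (_· N) _ ⟩
      𝔼 d₁ (λ M′ → expect k (F (M′ · N))) ≡⟨ disjoint-redexes k Fc r₁ r₂ ⟩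
      𝔼 d₂ (λ N′ → expect k (F (M · N′))) ≡⟨ sym (𝔼-mapD d₂ (M ·_) _) ⟩
      𝔼 (mapD (M ·_) d₂) (expect k ∘ F) ∎
      where open ≡-Reasoning
    reducts-agree k {F} Fc (appR {M} {N} {d₁} r₁) (appL {d = d₂} r₂) = begin
      𝔼 (mapD (M ·_) d₁) (expect k ∘ F) ≡⟨ 𝔼-mapD d₁ (M ·_) _ ⟩
      𝔼 d₁ (λ N′ → expect k (F (M · N′))) ≡⟨ sym (disjoint-redexes k Fc r₂ r₁) ⟩
      𝔼 d₂ (λ M′ → expect k (F (M′ · N))) ≡⟨ sym (𝔼-mapD d₂ (_· N) _) ⟩
      𝔼 (mapD (_· N) d₂) (expect k ∘ F) ∎
      where open ≡-Reasoning

    disjoint-redexes : ∀ k {F} → Compatible F → ∀ {M N d₁ d₂} → M ↦ d₁ → N ↦ d₂ →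
      𝔼 d₁ (λ M′ → expect k (F (M′ · N))) ≡ 𝔼 d₂ (λ N′ → expect k (F (M · N′)))
    disjoint-redexes zero Fc {d₁ = d₁} {d₂} r₁ r₂ =
      trans (𝔼-zero d₁ λ _ → observe-reducible (Fc (appR r₂)))
            (sym (𝔼-zero d₂ λ _ → observe-reducible (Fc (appL r₁))))
    disjoint-redexes (suc k) {F} Fc {M} {N} {d₁} {d₂} r₁ r₂ = begin
      𝔼 d₁ (λ M′ → expect (suc k) (F (M′ · N)))            ≡⟨ 𝔼-cong d₁ (λ _ → contract-N) ⟩
      𝔼 d₁ (λ M′ → 𝔼 d₂ (λ N′ → expect k (F (M′ · N′))))   ≡⟨ 𝔼-swap d₁ d₂ _ ⟩
      𝔼 d₂ (λ N′ → 𝔼 d₁ (λ M′ → expect k (F (M′ · N′))))   ≡⟨ 𝔼-cong d₂ (λ _ → sym contract-M) ⟩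
      𝔼 d₂ (λ N′ → expect (suc k) (F (M · N′)))            ∎
      where
      open ≡-Reasoning
      contract-N : ∀ {M′} → expect (suc k) (F (M′ · N)) ≡ 𝔼 d₂ (λ N′ → expect k (F (M′ · N′)))
      contract-N {M′} = trans (expect-step k (Fc (appR r₂)))
        (trans (𝔼-mapD (mapD (M′ ·_) d₂) F _) (𝔼-mapD d₂ (M′ ·_) _))
      contract-M : ∀ {N′} → expect (suc k) (F (M · N′)) ≡ 𝔼 d₁ (λ M′ → expect k (F (M′ · N′)))
      contract-M {N′} = trans (expect-step k (Fc (appL r₁)))
        (trans (𝔼-mapD (mapD (_· N′) d₁) F _) (𝔼-mapD d₁ (_· N′) _))

    expect-step : ∀ k {M d} → M ↦ d → expect (suc k) M ≡ 𝔼 d (expect k)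
    expect-step k {M} r with progress M
    ... | inj₁ nM       = ⊥-elim (nM _ r)
    ... | inj₂ (_ , r′) = reducts-agree k id-compatible r′ r

  mutual
    expect-⇒ : ∀ k {m n} → m ⇒ n → 𝔼 m (expect (suc k)) ≡ 𝔼 n (expect k)
    expect-⇒ k (L1 {M} nM) = begin
      𝔼 [ M ] (expect (suc k)) ≡⟨ 𝔼-[] M (expect (suc k)) ⟩
      expect (suc k) M         ≡⟨ expect-normal (suc k) nM ⟩
      observe M                ≡⟨ sym (expect-normal k nM) ⟩
      expect k M               ≡⟨ sym (𝔼-[] M (expect k)) ⟩
      𝔼 [ M ] (expect k)       ∎
      where open ≡-Reasoning
    expect-⇒ k (L2 {M} r) = trans (𝔼-[] M (expect (suc k))) (expect-step k r)
    expect-⇒ k (L3 l)     = expect-Lift k l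

    expect-Lift : ∀ k {m n} → Lift m n → 𝔼 m (expect (suc k)) ≡ 𝔼 n (expect k)
    expect-Lift k [] = refl
    expect-Lift k (_∷_ {p} {M} {mᵢ} {ms} {ns} r l) = begin
      p * expect (suc k) M + 𝔼 ms (expect (suc k))
        ≡⟨ cong₂ _+_ (cong (p *_) head) (expect-Lift k l) ⟩
      p * 𝔼 mᵢ (expect k) + 𝔼 ns (expect k)
        ≡⟨ cong (_+ 𝔼 ns (expect k)) (sym (𝔼-·m p mᵢ (expect k))) ⟩
      𝔼 (p ·m mᵢ) (expect k) + 𝔼 ns (expect k)
        ≡⟨ sym (𝔼-++ (p ·m mᵢ) ns (expect k)) ⟩
      𝔼 ((p ·m mᵢ) ++ ns) (expect k)
        ∎
      where
      open ≡-Reasoning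
      head : expect (suc k) M ≡ 𝔼 mᵢ (expect k)
      head = trans (sym (𝔼-[] M (expect (suc k)))) (expect-⇒ k r)

  expect-⇒^ : ∀ k {m s} → m ⇒^ k ∙ s → 𝔼 m (expect k) ≡ 𝔼 s observe
  expect-⇒^ zero    done          = refl
  expect-⇒^ (suc k) (more r rest) = trans (expect-⇒ k r) (expect-⇒^ k rest)

  observe-determined : ∀ {m k s t} → m ⇒^ k ∙ s → m ⇒^ k ∙ t → 𝔼 s observe ≡ 𝔼 t observe
  observe-determined {k = k} rs rt = trans (sym (expect-⇒^ k rs)) (expect-⇒^ k rt)

indicator : Term → Term → ℚ
indicator U M with M ≟T U
... | yes _ = 1ℚ
... | no _  = 0ℚ

module Indicator (U : Term) = Observation (indicator U)
module Termination = Observation (λ _ → 1ℚ)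

observe-indicator-self : ∀ {U} → Normal U → Indicator.observe U U ≡ 1ℚ
observe-indicator-self {U} nU with normal? U
... | no ¬nU = ⊥-elim (¬nU nU)
... | yes _ with U ≟T U
...   | yes _  = refl
...   | no U≢U = ⊥-elim (U≢U refl)

observe-indicator-other : ∀ {U M} → ¬ M ≡ U → Indicator.observe U M ≡ 0ℚ
observe-indicator-other {U} {M} M≢U with normal? M
... | no _ = refl
... | yes _ with M ≟T U
...   | yes M≡U = ⊥-elim (M≢U M≡U)
...   | no _    = refl

nf-as-𝔼 : ∀ {U} → Normal U → ∀ m → nf m U ≡ 𝔼 m (Indicator.observe U)
nf-as-𝔼 nU [] = refl
nf-as-𝔼 {U} nU ((p , M) ∷ m) with M ≟T U
... | yes refl = cong₂ _+_ (sym (trans (cong (p *_) (observe-indicator-self nU)) (*-identityʳ p)))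
                           (nf-as-𝔼 nU m)
... | no M≢U   = begin
  nf m U                                                ≡⟨ nf-as-𝔼 nU m ⟩
  𝔼 m (Indicator.observe U)                             ≡⟨ sym (+-identityˡ _) ⟩
  0ℚ + 𝔼 m (Indicator.observe U)                        ≡⟨ cong (_+ _) (sym p*0) ⟩
  p * Indicator.observe U M + 𝔼 m (Indicator.observe U) ∎
  where
  open ≡-Reasoning
  p*0 : p * Indicator.observe U M ≡ 0ℚ
  p*0 = trans (cong (p *_) (observe-indicator-other M≢U)) (*-zeroʳ p)

mass-as-𝔼 : ∀ m → mass m ≡ 𝔼 m Termination.observe
mass-as-𝔼 [] = refl
mass-as-𝔼 ((p , M) ∷ m) with normal? M
... | yes _ = cong₂ _+_ (sym (*-identityʳ p)) (mass-as-𝔼 m)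
... | no _  = begin
  mass m                           ≡⟨ mass-as-𝔼 m ⟩
  𝔼 m Termination.observe          ≡⟨ sym (+-identityˡ _) ⟩
  0ℚ + 𝔼 m Termination.observe     ≡⟨ cong (_+ _) (sym (*-zeroʳ p)) ⟩
  p * 0ℚ + 𝔼 m Termination.observe ∎
  where open ≡-Reasoning

nf-determined : ∀ {m k s t} → m ⇒^ k ∙ s → m ⇒^ k ∙ t → ∀ U → Normal U → nf s U ≡ nf t U
nf-determined {s = s} {t} rs rt U nU =
  trans (nf-as-𝔼 nU s) (trans (Indicator.observe-determined U rs rt) (sym (nf-as-𝔼 nU t)))

mass-determined : ∀ {m k s t} → m ⇒^ k ∙ s → m ⇒^ k ∙ t → mass s ≡ mass t
mass-determined {s = s} {t} rs rt =
  trans (mass-as-𝔼 s) (trans (Termination.observe-determined rs rt) (sym (mass-as-𝔼 t)))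

⇒^-snoc : ∀ {m k n o} → m ⇒^ k ∙ n → n ⇒ o → m ⇒^ suc k ∙ o
⇒^-snoc done           r = more r done
⇒^-snoc (more r′ rest) r = more r′ (⇒^-snoc rest r)

IsSeq-prefix : ∀ {m f} → IsSeq m f → ∀ n → m ⇒^ n ∙ f n
IsSeq-prefix (f0≡m , _)     zero    = ≡.subst (_⇒^ zero ∙ _) f0≡m done
IsSeq-prefix sf@(_ , steps) (suc n) = ⇒^-snoc (IsSeq-prefix sf n) (steps n)

SupLe-≗ : ∀ {a b} → a ≗ b → SupLe a b
SupLe-≗ {a} {b} a≗b n ε ε>0 =
  n , ≡.subst (_≤ b n + ε) (trans (+-identityʳ (b n)) (sym (a≗b n))) (+-monoʳ-≤ (b n) (<⇒≤ ε>0))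

SupEq-≗ : ∀ {a b} → a ≗ b → SupEq a b
SupEq-≗ a≗b = SupLe-≗ a≗b , SupLe-≗ (sym ∘ a≗b)

partialTime-cong : ∀ {f g} → (∀ n → mass (f n) ≡ mass (g n)) → partialTime f ≗ partialTime g
partialTime-cong mass≡ zero    = refl
partialTime-cong mass≡ (suc n) = cong₂ _+_ (partialTime-cong mass≡ n) (cong (1ℚ -_) (mass≡ n))

mainTheorem17 : ∀ (m : MDist) → IsMultidist m →
    (∀ f g → IsSeq m f → IsSeq m g → SameLimit f g)
    × (∀ f g → IsSeq m f → IsSeq m g → SameMeanTime f g)
    × (∀ (k : ℕ) s t → m ⇒^ k ∙ s → m ⇒^ k ∙ t → ∀ U → Normal U → nf s U ≡ nf t U)
mainTheorem17 m _ = sameLimit , sameMeanTime , λ _ _ _ → nf-determined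
  where
  sameLimit : ∀ f g → IsSeq m f → IsSeq m g → SameLimit f g
  sameLimit f g sf sg U nU =
    SupEq-≗ λ n → nf-determined (IsSeq-prefix sf n) (IsSeq-prefix sg n) U nU
  sameMeanTime : ∀ f g → IsSeq m f → IsSeq m g → SameMeanTime f g
  sameMeanTime f g sf sg =
    SupEq-≗ (partialTime-cong λ n → mass-determined (IsSeq-prefix sf n) (IsSeq-prefix sg n))
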